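{- Let $n,k,t,s$ be positive integers with $k\geq t+1$ and $n\geq (t+1)(k-t+1)^{2}$. Suppose that $\mathcal{F},\mathcal{G}\subseteq\binom{[n]}{k}$ are non-empty $s$-almost cross-$t$-intersecting families. If $\tau_t(\mathcal{F})\leq k$ and $\tau_t(\mathcal{G})\leq k$, then $$|\mathcal{F}||\mathcal{G}|\leq f_1(n,k,t,s,\tau_t(\mathcal{F}))\,f_1(n,k,t,s,\tau_t(\mathcal{G})),$$ where for a positive integer $x$, $$f_1(n,k,t,s,x)=(k-t+1)^{x-t}\binom{x}{t}\binom{n-x}{k-x}+\sum_{i=0}^{x-t-1}s(k-t+1)^{i}\binom{x}{t}.$$
   Context: $[n]=\{1,\dots,n\}$, $\binom{X}{k}$ is the family of $k$-subsets of $X$. Two sets are $t$-disjoint if they share fewer than $t$ elements. Families $\mathcal{F},\mathcal{G}$ are $s$-almost cross-$t$-intersecting if each member of $\mathcal{F}$ is $t$-disjoint with at most $s$ members of $\mathcal{G}$ and vice versa. A $t$-cover of a family $\mathcal{F}$ is a set $T\subseteq[n]$ with $|T\cap F|\geq t$ for all $F\in\mathcal{F}$; $\tau_t(\mathcal{F})$ is the minimum size of a $t$-cover of $\mathcal{F}$. The paper assumes throughout that $s$-almost cross-$t$-intersecting families are non-empty. -}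

module Defs where

open import Data.Nat using (ℕ; zero; suc; _+_; _*_; _∸_; _^_; _≤_; _<_; _<?_)
open import Data.Nat.Combinatorics using (_C_)
open import Data.Fin.Subset using (Subset; _∩_; ∣_∣)
open import Data.List using (List; length; filter)
open import Data.List.Membership.Propositional using (_∈_)
open import Data.List.Relation.Unary.All using (All)
open import Data.List.Relation.Unary.Unique.Propositional using (Unique)
open import Relation.Binary.PropositionalEquality using (_≡_)
open import Data.Product using (_×_)

record Family (n : ℕ) : Set where
  constructor mkFamily
  field
    members : List (Subset n)
    unique  : Unique members
open Family public

card : ∀ {n} → Family n → ℕ
card 𝓕 = length (members 𝓕)

Uniform : ∀ {n} → ℕ → Family n → Set
Uniform k 𝓕 = All (λ A → ∣ A ∣ ≡ k) (members 𝓕)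

tDisjointCount : ∀ {n} → ℕ → Subset n → Family n → ℕ
tDisjointCount t A 𝓖 = length (filter (λ B → ∣ A ∩ B ∣ <? t) (members 𝓖))

AlmostCrossInt : ∀ {n} → ℕ → ℕ → Family n → Family n → Set
AlmostCrossInt s t 𝓕 𝓖 =
  (∀ A → A ∈ members 𝓕 → tDisjointCount t A 𝓖 ≤ s) ×
  (∀ B → B ∈ members 𝓖 → tDisjointCount t B 𝓕 ≤ s)

IsTCover : ∀ {n} → ℕ → Family n → Subset n → Set
IsTCover t 𝓕 T = ∀ A → A ∈ members 𝓕 → t ≤ ∣ T ∩ A ∣

IsTauT : ∀ {n} → ℕ → Family n → ℕ → Set
IsTauT {n} t 𝓕 x =
  (Data.Product.Σ (Subset n) λ T → IsTCover t 𝓕 T × ∣ T ∣ ≡ x) ×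
  (∀ T → IsTCover t 𝓕 T → x ≤ ∣ T ∣)

sumBelow : ℕ → (ℕ → ℕ) → ℕ
sumBelow zero    f = 0
sumBelow (suc m) f = sumBelow m f + f m

f₁ : ℕ → ℕ → ℕ → ℕ → ℕ → ℕ
f₁ n k t s x =
  (k ∸ t + 1) ^ (x ∸ t) * (x C t) * ((n ∸ x) C (k ∸ x))
  + sumBelow (x ∸ t) (λ i → s * (k ∸ t + 1) ^ i * (x C t))

-- Let T be a minimum t-cover of 𝓕, so |T| = x and every member of 𝓕 contains a
-- t-subset of T; hence |𝓕| ≤ C(x,t) · max |𝓕(S)| over t-sets S, where the degree
-- |𝓕(S)| counts the members containing S. If |S| < y = τ_t(𝓖), then S is not a
-- t-cover of 𝓖, so some G ∈ 𝓖 meets S in fewer than t points, and G ∖ S contains a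
-- set W of size r = k - t + 1. A member A ⊇ S of 𝓕 is either t-disjoint from G (at
-- most s such A) or meets W, since r + t > k = |G|; so A ⊇ S ∪ {w} for some w ∈ W.
-- Thus g(y - |S|) bounds |𝓕(S)|, where g(0) = C(n-y, k-y) (k-sets containing a
-- y-set) and g(d+1) = s + r g(d). So |𝓕| ≤ C(x,t) g_y(y-t) and symmetrically
-- |𝓖| ≤ C(y,t) g_x(x-t); regrouping the product gives f₁(x) f₁(y), because
-- C(x,t) g_x(x-t) = f₁(x).
module Submission where

open import Defs
open import Level using (Level)
open import Function using (id; case_of_)
open import Data.Bool using (_≟_)
open import Data.Nat using (ℕ; zero; suc; _+_; _*_; _∸_; _^_; _≤_; _<_; _≤?_; _<?_; z≤n; s≤s; z<s)
open import Data.Nat.Properties hiding (_≟_)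
open import Data.Nat.Combinatorics using (_C_; nC1≡n; nCk+nC[k+1]≡[n+1]C[k+1])
open import Data.Nat.Solver using (module +-*-Solver)
open +-*-Solver using (solve; _:+_; _:*_; _:=_; con)
open import Data.Vec using (_∷_; []; here; there)
open import Data.Fin.Subset using (Subset; Side; inside; outside; _∩_; _∪_; _─_; ∁; ∣_∣; _⊆_; ⊥)
open import Data.Fin.Subset.Properties
  using (_⊆?_; ⊆-trans; drop-∷-⊆; out⊆; s⊆s; ⊥⊆; ∣⊥∣≡0; ∣p∣≤n; p⊆q⇒∣p∣≤∣q∣; ∩-idem; ∩-comm;
         ∣p∩q∣≤∣p∣; x∈p∪q⁻; p─q⊆p)
open import Data.List using (List; []; _∷_; [_]; length; filter; map; _++_)
open import Data.List.Properties using (length-map; length-++; filter-none; filter-all)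
open import Data.List.Membership.Propositional using (_∈_; find)
open import Data.List.Relation.Unary.All as All using (All; []; _∷_)
import Data.List.Relation.Unary.All.Properties as Allₚ
open import Data.List.Relation.Unary.Any as Any using (Any; here; there; any?)
import Data.List.Relation.Unary.Any.Properties as Anyₚ
open import Data.List.Relation.Unary.Unique.Propositional using (Unique; []; _∷_)
import Data.List.Relation.Unary.Unique.Propositional.Properties as Uniqueₚ
open import Data.Product as Product using (∃; _×_; _,_; proj₂; map₁)
open import Data.Sum using (_⊎_; inj₁; inj₂; [_,_]′)
open import Relation.Nullary using (¬_; yes; no; contradiction)
open import Relation.Nullary.Decidable using (_×-dec_)
open import Relation.Unary using (Pred; Decidable)
open import Relation.Binary.PropositionalEquality
  using (_≡_; _≢_; refl; sym; trans; cong; cong₂; subst; subst₂; module ≡-Reasoning)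

private
  variable
    a i ℓ₁ ℓ₂ ℓ₃ : Level
    A : Set a
    n : ℕ

length-filter-∷ : ∀ {P : Pred A ℓ₁} (P? : Decidable P) x xs →
  length (filter P? xs) ≤ length (filter P? (x ∷ xs))
length-filter-∷ P? x xs with P? x
... | yes _ = n≤1+n _
... | no  _ = ≤-refl

length-filter-⊎ : ∀ {P : Pred A ℓ₁} {Q : Pred A ℓ₂} {R : Pred A ℓ₃}
  (P? : Decidable P) (Q? : Decidable Q) (R? : Decidable R) →
  (∀ {x} → P x → Q x ⊎ R x) → ∀ xs →
  length (filter P? xs) ≤ length (filter Q? xs) + length (filter R? xs)
length-filter-⊎ P? Q? R? split []       = z≤n
length-filter-⊎ P? Q? R? split (x ∷ xs) with ih ← length-filter-⊎ P? Q? R? split xs | P? x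
... | no _ = ≤-trans ih (+-mono-≤ (length-filter-∷ Q? x xs) (length-filter-∷ R? x xs))
... | yes px with Q? x
...   | yes _ = s≤s (≤-trans ih (+-monoʳ-≤ _ (length-filter-∷ R? x xs)))
...   | no ¬qx with R? x
...     | yes _  = ≤-trans (s≤s ih) (≤-reflexive (sym (+-suc _ _)))
...     | no ¬rx = contradiction (split px) [ ¬qx , ¬rx ]′

length-filter-⋃ : ∀ {P : Pred A ℓ₁} (P? : Decidable P) {I : Set i} {Q : I → Pred A ℓ₂}
  (Q? : ∀ j → Decidable (Q j)) {B} (js : List I) xs →
  (∀ {x} → P x → Any (λ j → Q j x) js) →
  All (λ j → length (filter (Q? j) xs) ≤ B) js →
  length (filter P? xs) ≤ length js * B
length-filter-⋃ P? Q? []       xs cover [] =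
  ≤-reflexive (cong length (filter-none P? {xs} (All.tabulate (λ _ px → case cover px of λ ()))))
length-filter-⋃ {P = P} P? {Q = Q} Q? (j ∷ js) xs cover (bound ∷ bounds) =
  ≤-trans (length-filter-⊎ P? (Q? j) (λ x → any? (λ j → Q? j x) js) split xs)
          (+-mono-≤ bound (length-filter-⋃ _ Q? js xs id bounds))
  where
  split : ∀ {x} → P x → Q j x ⊎ Any (λ j → Q j x) js
  split px with cover px
  ... | here  qx  = inj₁ qx
  ... | there qxs = inj₂ qxs

All-absurd⇒length≡0 : ∀ {P : Pred A ℓ₁} {xs} → (∀ {x} → ¬ P x) → All P xs → length xs ≡ 0
All-absurd⇒length≡0 ¬P []       = refl
All-absurd⇒length≡0 ¬P (Px ∷ _) = contradiction Px ¬P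

p─q⊆∁q : ∀ (p q : Subset n) → p ─ q ⊆ ∁ q
p─q⊆∁q (inside ∷ p) (outside ∷ q) here      = here
p─q⊆∁q (_      ∷ p) (outside ∷ q) (there x) = there (p─q⊆∁q p q x)
p─q⊆∁q (_      ∷ p) (inside  ∷ q) (there x) = there (p─q⊆∁q p q x)

∪-⊆ : ∀ {p q r : Subset n} → p ⊆ r → q ⊆ r → p ∪ q ⊆ r
∪-⊆ {p = p} {q} p⊆r q⊆r x∈p∪q = [ p⊆r , q⊆r ]′ (x∈p∪q⁻ p q x∈p∪q)

∣p∪q∣≡∣p∣+∣q∣ : ∀ (p q : Subset n) → q ⊆ ∁ p → ∣ p ∪ q ∣ ≡ ∣ p ∣ + ∣ q ∣
∣p∪q∣≡∣p∣+∣q∣ []            []            _ = refl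
∣p∪q∣≡∣p∣+∣q∣ (outside ∷ p) (outside ∷ q) h = ∣p∪q∣≡∣p∣+∣q∣ p q (drop-∷-⊆ h)
∣p∪q∣≡∣p∣+∣q∣ (outside ∷ p) (inside  ∷ q) h =
  trans (cong suc (∣p∪q∣≡∣p∣+∣q∣ p q (drop-∷-⊆ h))) (sym (+-suc ∣ p ∣ ∣ q ∣))
∣p∪q∣≡∣p∣+∣q∣ (inside  ∷ p) (outside ∷ q) h = cong suc (∣p∪q∣≡∣p∣+∣q∣ p q (drop-∷-⊆ h))
∣p∪q∣≡∣p∣+∣q∣ (inside  ∷ p) (inside  ∷ q) h = contradiction (h here) λ ()

∣p∣≡∣p─q∣+∣p∩q∣ : ∀ (p q : Subset n) → ∣ p ∣ ≡ ∣ p ─ q ∣ + ∣ p ∩ q ∣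
∣p∣≡∣p─q∣+∣p∩q∣ []            []            = refl
∣p∣≡∣p─q∣+∣p∩q∣ (outside ∷ p) (outside ∷ q) = ∣p∣≡∣p─q∣+∣p∩q∣ p q
∣p∣≡∣p─q∣+∣p∩q∣ (outside ∷ p) (inside  ∷ q) = ∣p∣≡∣p─q∣+∣p∩q∣ p q
∣p∣≡∣p─q∣+∣p∩q∣ (inside  ∷ p) (outside ∷ q) = cong suc (∣p∣≡∣p─q∣+∣p∩q∣ p q)
∣p∣≡∣p─q∣+∣p∩q∣ (inside  ∷ p) (inside  ∷ q) =
  trans (cong suc (∣p∣≡∣p─q∣+∣p∩q∣ p q)) (sym (+-suc ∣ p ─ q ∣ ∣ p ∩ q ∣))

p⊆q⇒∣p∣+∣q∩r∣≤∣q∣+∣p∩r∣ : ∀ (p q r : Subset n) → p ⊆ q → ∣ p ∣ + ∣ q ∩ r ∣ ≤ ∣ q ∣ + ∣ p ∩ r ∣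
p⊆q⇒∣p∣+∣q∩r∣≤∣q∣+∣p∩r∣ []            []            []            _ = z≤n
p⊆q⇒∣p∣+∣q∩r∣≤∣q∣+∣p∩r∣ (outside ∷ p) (outside ∷ q) (_       ∷ r) h =
  p⊆q⇒∣p∣+∣q∩r∣≤∣q∣+∣p∩r∣ p q r (drop-∷-⊆ h)
p⊆q⇒∣p∣+∣q∩r∣≤∣q∣+∣p∩r∣ (outside ∷ p) (inside  ∷ q) (outside ∷ r) h =
  m≤n⇒m≤1+n (p⊆q⇒∣p∣+∣q∩r∣≤∣q∣+∣p∩r∣ p q r (drop-∷-⊆ h))
p⊆q⇒∣p∣+∣q∩r∣≤∣q∣+∣p∩r∣ (outside ∷ p) (inside  ∷ q) (inside  ∷ r) h =
  subst (_≤ suc (∣ q ∣ + ∣ p ∩ r ∣)) (sym (+-suc ∣ p ∣ ∣ q ∩ r ∣))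
        (s≤s (p⊆q⇒∣p∣+∣q∩r∣≤∣q∣+∣p∩r∣ p q r (drop-∷-⊆ h)))
p⊆q⇒∣p∣+∣q∩r∣≤∣q∣+∣p∩r∣ (inside  ∷ p) (outside ∷ q) _             h = contradiction (h here) λ ()
p⊆q⇒∣p∣+∣q∩r∣≤∣q∣+∣p∩r∣ (inside  ∷ p) (inside  ∷ q) (outside ∷ r) h =
  s≤s (p⊆q⇒∣p∣+∣q∩r∣≤∣q∣+∣p∩r∣ p q r (drop-∷-⊆ h))
p⊆q⇒∣p∣+∣q∩r∣≤∣q∣+∣p∩r∣ (inside  ∷ p) (inside  ∷ q) (inside  ∷ r) h =
  s≤s (subst₂ _≤_ (sym (+-suc ∣ p ∣ ∣ q ∩ r ∣)) (sym (+-suc ∣ q ∣ ∣ p ∩ r ∣))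
                 (s≤s (p⊆q⇒∣p∣+∣q∩r∣≤∣q∣+∣p∩r∣ p q r (drop-∷-⊆ h))))

subsets : Subset n → ℕ → List (Subset n)
subsets _             zero    = [ ⊥ ]
subsets []            (suc j) = []
subsets (outside ∷ p) (suc j) = map (outside ∷_) (subsets p (suc j))
subsets (inside  ∷ p) (suc j) = map (inside ∷_) (subsets p j) ++ map (outside ∷_) (subsets p (suc j))

length-subsets : ∀ (p : Subset n) j → length (subsets p j) ≡ ∣ p ∣ C j
length-subsets _             zero    = refl
length-subsets []            (suc j) = refl
length-subsets (outside ∷ p) (suc j) =
  trans (length-map (outside ∷_) (subsets p (suc j))) (length-subsets p (suc j))
length-subsets (inside  ∷ p) (suc j) = begin
  length (map (inside ∷_) (subsets p j) ++ map (outside ∷_) (subsets p (suc j)))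
    ≡⟨ length-++ (map (inside ∷_) (subsets p j)) ⟩
  length (map (inside ∷_) (subsets p j)) + length (map (outside ∷_) (subsets p (suc j)))
    ≡⟨ cong₂ _+_ (length-map (inside ∷_) (subsets p j)) (length-map (outside ∷_) (subsets p (suc j))) ⟩
  length (subsets p j) + length (subsets p (suc j))
    ≡⟨ cong₂ _+_ (length-subsets p j) (length-subsets p (suc j)) ⟩
  ∣ p ∣ C j + ∣ p ∣ C suc j
    ≡⟨ nCk+nC[k+1]≡[n+1]C[k+1] ∣ p ∣ j ⟩
  suc ∣ p ∣ C suc j ∎
  where open ≡-Reasoning

subsets-⊆∧size : ∀ (p : Subset n) j → All (λ s → s ⊆ p × ∣ s ∣ ≡ j) (subsets p j)
subsets-⊆∧size {n} p         zero    = (⊥⊆ , ∣⊥∣≡0 n) ∷ []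
subsets-⊆∧size []            (suc j) = []
subsets-⊆∧size (outside ∷ p) (suc j) = Allₚ.map⁺ (All.map (map₁ out⊆) (subsets-⊆∧size p (suc j)))
subsets-⊆∧size (inside  ∷ p) (suc j) = Allₚ.++⁺
  (Allₚ.map⁺ (All.map (Product.map s⊆s (cong suc)) (subsets-⊆∧size p j)))
  (Allₚ.map⁺ (All.map (map₁ out⊆) (subsets-⊆∧size p (suc j))))

subsets-⊆ : ∀ (p q : Subset n) j → j ≤ ∣ p ∩ q ∣ → Any (_⊆ q) (subsets p j)
subsets-⊆ p             q             zero    _         = here ⊥⊆
subsets-⊆ []            []            (suc j) ()
subsets-⊆ (outside ∷ p) (_ ∷ q)       (suc j) j<∣p∩q∣   =
  Anyₚ.map⁺ (Any.map out⊆ (subsets-⊆ p q (suc j) j<∣p∩q∣))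
subsets-⊆ (inside  ∷ p) (inside ∷ q)  (suc j) (s≤s j≤) =
  Anyₚ.++⁺ˡ (Anyₚ.map⁺ (Any.map s⊆s (subsets-⊆ p q j j≤)))
subsets-⊆ (inside  ∷ p) (outside ∷ q) (suc j) j<∣p∩q∣   =
  Anyₚ.++⁺ʳ (map (inside ∷_) (subsets p j)) (Anyₚ.map⁺ (Any.map out⊆ (subsets-⊆ p q (suc j) j<∣p∩q∣)))

∃-subset-of-size : ∀ (p : Subset n) j → j ≤ ∣ p ∣ → ∃ λ s → s ⊆ p × ∣ s ∣ ≡ j
∃-subset-of-size p j j≤∣p∣ with find (subsets-⊆ p p j (subst (j ≤_) (cong ∣_∣ (sym (∩-idem p))) j≤∣p∣))
... | s , s∈ , s⊆p = s , s⊆p , proj₂ (All.lookup (subsets-⊆∧size p j) s∈)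

tailsWith : Side → List (Subset (suc n)) → List (Subset n)
tailsWith b []             = []
tailsWith b ((c ∷ p) ∷ ps) with c ≟ b
... | yes _ = p ∷ tailsWith b ps
... | no  _ = tailsWith b ps

length-tailsWith : ∀ (ps : List (Subset (suc n))) →
  length ps ≡ length (tailsWith inside ps) + length (tailsWith outside ps)
length-tailsWith []                   = refl
length-tailsWith ((inside  ∷ p) ∷ ps) = cong suc (length-tailsWith ps)
length-tailsWith ((outside ∷ p) ∷ ps) = trans (cong suc (length-tailsWith ps)) (sym (+-suc _ _))

tailsWith⁺ : ∀ {P : Pred (Subset (suc n)) ℓ₁} b {ps} → All P ps → All (λ p → P (b ∷ p)) (tailsWith b ps)
tailsWith⁺ b {[]}           []          = []
tailsWith⁺ b {(c ∷ p) ∷ ps} (Pcp ∷ Pps) with c ≟ b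
... | yes refl = Pcp ∷ tailsWith⁺ b Pps
... | no  _    = tailsWith⁺ b Pps

tailsWith-Unique : ∀ b {ps : List (Subset (suc n))} → Unique ps → Unique (tailsWith b ps)
tailsWith-Unique b {[]}           []           = []
tailsWith-Unique b {(c ∷ p) ∷ ps} (p∉ps ∷ ps!) with c ≟ b
... | yes refl = All.map (λ ≢ ≡ → ≢ (cong (b ∷_) ≡)) (tailsWith⁺ b p∉ps) ∷ tailsWith-Unique b ps!
... | no  _    = tailsWith-Unique b ps!

length-supersets≤C : ∀ (s : Subset n) j {ps} → Unique ps →
  All (λ p → s ⊆ p × ∣ p ∣ ≡ ∣ s ∣ + j) ps → length ps ≤ (n ∸ ∣ s ∣) C j
length-supersets≤C []  j       {[]}          _                _ = z≤n
length-supersets≤C []  zero    {[] ∷ []}     _                _ = ≤-refl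
length-supersets≤C []  zero    {[] ∷ [] ∷ _} ((≢ ∷ _) ∷ _)    _ = contradiction refl ≢
length-supersets≤C []  (suc j) {[] ∷ _}      _ ((_ , ()) ∷ _)
length-supersets≤C {suc n} (inside ∷ s) j {ps} ps! sup = begin
  length ps                 ≡⟨ length-tailsWith ps ⟩
  length ins + length outs  ≡⟨ cong (length ins +_) outs-empty ⟩
  length ins + 0            ≡⟨ +-identityʳ (length ins) ⟩
  length ins                ≤⟨ length-supersets≤C s j (tailsWith-Unique inside ps!) ins-sup ⟩
  (n ∸ ∣ s ∣) C j           ∎
  where
  open ≤-Reasoning
  ins  = tailsWith inside ps
  outs = tailsWith outside ps
  ins-sup : All (λ p → s ⊆ p × ∣ p ∣ ≡ ∣ s ∣ + j) ins
  ins-sup = All.map (Product.map drop-∷-⊆ suc-injective) (tailsWith⁺ inside sup)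
  outs-empty : length outs ≡ 0
  outs-empty = All-absurd⇒length≡0 (λ (s⊆p , _) → contradiction (s⊆p here) λ ()) (tailsWith⁺ outside sup)
length-supersets≤C {suc n} (outside ∷ s) zero {ps} ps! sup = begin
  length ps                 ≡⟨ length-tailsWith ps ⟩
  length ins + length outs  ≡⟨ cong (_+ length outs) ins-empty ⟩
  length outs               ≤⟨ length-supersets≤C s zero (tailsWith-Unique outside ps!) outs-sup ⟩
  1                         ∎
  where
  open ≤-Reasoning
  ins  = tailsWith inside ps
  outs = tailsWith outside ps
  too-small : ∀ {p} → ¬ (outside ∷ s ⊆ inside ∷ p × suc ∣ p ∣ ≡ ∣ s ∣ + 0)
  too-small (s⊆p , ∣p∣<∣s∣) =
    <⇒≱ (≤-reflexive (trans ∣p∣<∣s∣ (+-identityʳ ∣ s ∣))) (p⊆q⇒∣p∣≤∣q∣ (drop-∷-⊆ s⊆p))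
  ins-empty : length ins ≡ 0
  ins-empty = All-absurd⇒length≡0 too-small (tailsWith⁺ inside sup)
  outs-sup : All (λ p → s ⊆ p × ∣ p ∣ ≡ ∣ s ∣ + 0) outs
  outs-sup = All.map (map₁ drop-∷-⊆) (tailsWith⁺ outside sup)
length-supersets≤C {suc n} (outside ∷ s) (suc j) {ps} ps! sup = begin
  length ps                              ≡⟨ length-tailsWith ps ⟩
  length ins + length outs               ≤⟨ +-mono-≤ ins-bound outs-bound ⟩
  (n ∸ ∣ s ∣) C j + (n ∸ ∣ s ∣) C suc j  ≡⟨ nCk+nC[k+1]≡[n+1]C[k+1] (n ∸ ∣ s ∣) j ⟩
  suc (n ∸ ∣ s ∣) C suc j                ≡⟨ cong (_C suc j) (+-∸-assoc 1 (∣p∣≤n s)) ⟨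
  (suc n ∸ ∣ s ∣) C suc j                ∎
  where
  open ≤-Reasoning
  ins  = tailsWith inside ps
  outs = tailsWith outside ps
  ins-bound : length ins ≤ (n ∸ ∣ s ∣) C j
  ins-bound = length-supersets≤C s j (tailsWith-Unique inside ps!)
    (All.map (Product.map drop-∷-⊆ (λ e → suc-injective (trans e (+-suc ∣ s ∣ j)))) (tailsWith⁺ inside sup))
  outs-bound : length outs ≤ (n ∸ ∣ s ∣) C suc j
  outs-bound = length-supersets≤C s (suc j) (tailsWith-Unique outside ps!)
    (All.map (map₁ drop-∷-⊆) (tailsWith⁺ outside sup))

sumBelow-geometric : ∀ (f : ℕ → ℕ) r → (∀ i → f (suc i) ≡ r * f i) →
  ∀ d → r * sumBelow d f + f 0 ≡ sumBelow (suc d) f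
sumBelow-geometric f r f[1+i]≡r*f[i] zero    = cong (_+ f 0) (*-zeroʳ r)
sumBelow-geometric f r f[1+i]≡r*f[i] (suc d) = begin
  r * (sumBelow d f + f d) + f 0
    ≡⟨ solve 4 (λ r Σ x y → r :* (Σ :+ x) :+ y := (r :* Σ :+ y) :+ r :* x) refl r (sumBelow d f) (f d) (f 0) ⟩
  (r * sumBelow d f + f 0) + r * f d
    ≡⟨ cong₂ _+_ (sumBelow-geometric f r f[1+i]≡r*f[i] d) (sym (f[1+i]≡r*f[i] d)) ⟩
  sumBelow (suc d) f + f (suc d) ∎
  where open ≡-Reasoning

branchingBound : ℕ → ℕ → ℕ → ℕ → ℕ
branchingBound r s D zero    = D
branchingBound r s D (suc d) = s + r * branchingBound r s D d

*-branchingBound : ∀ r s c D d →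
  c * branchingBound r s D d ≡ r ^ d * c * D + sumBelow d (λ i → s * r ^ i * c)
*-branchingBound r s c D zero    = solve 2 (λ c D → c :* D := con 1 :* c :* D :+ con 0) refl c D
*-branchingBound r s c D (suc d) = begin
  c * (s + r * branchingBound r s D d)
    ≡⟨ solve 4 (λ c s r X → c :* (s :+ r :* X) := r :* (c :* X) :+ s :* c) refl c s r (branchingBound r s D d) ⟩
  r * (c * branchingBound r s D d) + s * c
    ≡⟨ cong (λ X → r * X + s * c) (*-branchingBound r s c D d) ⟩
  r * (r ^ d * c * D + sumBelow d f) + s * c
    ≡⟨ solve 6 (λ r R c D Σ s → r :* (R :* c :* D :+ Σ) :+ s :* c := r :* R :* c :* D :+ (r :* Σ :+ s :* con 1 :* c))
               refl r (r ^ d) c D (sumBelow d f) s ⟩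
  r * r ^ d * c * D + (r * sumBelow d f + f 0)
    ≡⟨ cong (r * r ^ d * c * D +_) (sumBelow-geometric f r f[1+i]≡r*f[i] d) ⟩
  r * r ^ d * c * D + sumBelow (suc d) f ∎
  where
  open ≡-Reasoning
  f : ℕ → ℕ
  f i = s * r ^ i * c
  f[1+i]≡r*f[i] : ∀ i → f (suc i) ≡ r * f i
  f[1+i]≡r*f[i] i = solve 4 (λ s r R c → s :* (r :* R) :* c := r :* (s :* R :* c)) refl s r (r ^ i) c

t≤τ : ∀ {t x} (𝓕 : Family n) → members 𝓕 ≢ [] → IsTauT t 𝓕 x → t ≤ x
t≤τ (mkFamily []      _) []≢[] _                          = contradiction refl []≢[]
t≤τ (mkFamily (A ∷ _) _) _     ((T , T-cover , refl) , _) = ≤-trans (T-cover A (here refl)) (∣p∩q∣≤∣p∣ T A)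

module Degree {n} (k t s : ℕ) (t≤k : t ≤ k) (𝓕 𝓖 : Family n)
  (𝓕-uniform : Uniform k 𝓕) (𝓖-uniform : Uniform k 𝓖) (𝓖≢[] : members 𝓖 ≢ [])
  (𝓖-almost : ∀ B → B ∈ members 𝓖 → tDisjointCount t B 𝓕 ≤ s)
  {y} (τ𝓖 : IsTauT t 𝓖 y) (y≤k : y ≤ k) where

  r : ℕ
  r = k ∸ t + 1

  r+t≡1+k : r + t ≡ suc k
  r+t≡1+k = begin
    k ∸ t + 1 + t   ≡⟨ +-assoc (k ∸ t) 1 t ⟩
    k ∸ t + suc t   ≡⟨ +-suc (k ∸ t) t ⟩
    suc (k ∸ t + t) ≡⟨ cong suc (m∸n+n≡m t≤k) ⟩
    suc k           ∎
    where open ≡-Reasoning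

  degree : Subset n → ℕ
  degree S = length (filter (S ⊆?_) (members 𝓕))

  bound : ℕ → ℕ
  bound = branchingBound r s ((n ∸ y) C (k ∸ y))

  degree-base : ∀ S → ∣ S ∣ ≡ y → degree S ≤ bound 0
  degree-base S ∣S∣≡y = subst (λ m → degree S ≤ (n ∸ m) C (k ∸ y)) ∣S∣≡y
    (length-supersets≤C S (k ∸ y) (Uniqueₚ.filter⁺ (S ⊆?_) (unique 𝓕)) supersets)
    where
    size : ∀ {A} → ∣ A ∣ ≡ k → ∣ A ∣ ≡ ∣ S ∣ + (k ∸ y)
    size ∣A∣≡k = trans ∣A∣≡k (sym (trans (cong (_+ (k ∸ y)) ∣S∣≡y) (m+[n∸m]≡n y≤k)))
    supersets : All (λ A → S ⊆ A × ∣ A ∣ ≡ ∣ S ∣ + (k ∸ y)) (filter (S ⊆?_) (members 𝓕))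
    supersets = All.zip ( Allₚ.all-filter (S ⊆?_) (members 𝓕)
                        , Allₚ.filter⁺ (S ⊆?_) (All.map (λ {A} → size {A}) 𝓕-uniform))

  r≤∣G─S∣ : ∀ {G S} → G ∈ members 𝓖 → ∣ S ∩ G ∣ < t → r ≤ ∣ G ─ S ∣
  r≤∣G─S∣ {G} {S} G∈𝓖 ∣S∩G∣<t = +-cancelʳ-≤ t r ∣ G ─ S ∣ (begin
    r + t                       ≡⟨ r+t≡1+k ⟩
    suc k                       ≡⟨ cong suc (All.lookup 𝓖-uniform G∈𝓖) ⟨
    suc ∣ G ∣                    ≡⟨ cong suc (∣p∣≡∣p─q∣+∣p∩q∣ G S) ⟩
    suc (∣ G ─ S ∣ + ∣ G ∩ S ∣) ≡⟨ +-suc ∣ G ─ S ∣ ∣ G ∩ S ∣ ⟨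
    ∣ G ─ S ∣ + suc ∣ G ∩ S ∣   ≤⟨ +-monoʳ-≤ ∣ G ─ S ∣ (subst (_< t) (cong ∣_∣ (∩-comm S G)) ∣S∩G∣<t) ⟩
    ∣ G ─ S ∣ + t               ∎)
    where open ≤-Reasoning

  t≤∣G∩A∣⇒1≤∣W∩A∣ : ∀ {G W A} → G ∈ members 𝓖 → W ⊆ G → ∣ W ∣ ≡ r → t ≤ ∣ G ∩ A ∣ → 1 ≤ ∣ W ∩ A ∣
  t≤∣G∩A∣⇒1≤∣W∩A∣ {G} {W} {A} G∈𝓖 W⊆G ∣W∣≡r t≤∣G∩A∣ = +-cancelˡ-≤ k 1 ∣ W ∩ A ∣ (begin
    k + 1               ≡⟨ +-comm k 1 ⟩
    suc k               ≡⟨ r+t≡1+k ⟨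
    r + t               ≤⟨ +-mono-≤ (≤-reflexive (sym ∣W∣≡r)) t≤∣G∩A∣ ⟩
    ∣ W ∣ + ∣ G ∩ A ∣   ≤⟨ p⊆q⇒∣p∣+∣q∩r∣≤∣q∣+∣p∩r∣ W G A W⊆G ⟩
    ∣ G ∣ + ∣ W ∩ A ∣   ≡⟨ cong (_+ ∣ W ∩ A ∣) (All.lookup 𝓖-uniform G∈𝓖) ⟩
    k + ∣ W ∩ A ∣       ∎)
    where open ≤-Reasoning

  degree-step : ∀ {d S G} → (∀ S′ → ∣ S′ ∣ + d ≡ y → degree S′ ≤ bound d) →
    ∣ S ∣ + suc d ≡ y → G ∈ members 𝓖 → ∣ S ∩ G ∣ < t → degree S ≤ bound (suc d)
  degree-step {d} {S} {G} degree≤ ∣S∣+1+d≡y G∈𝓖 ∣S∩G∣<t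
    with W , W⊆G─S , ∣W∣≡r ← ∃-subset-of-size (G ─ S) r (r≤∣G─S∣ G∈𝓖 ∣S∩G∣<t) = begin
    degree S
      ≤⟨ length-filter-⊎ (S ⊆?_) (λ A → ∣ G ∩ A ∣ <? t) t-meets-G? split (members 𝓕) ⟩
    tDisjointCount t G 𝓕 + length (filter t-meets-G? (members 𝓕))
      ≤⟨ +-mono-≤ (𝓖-almost G G∈𝓖)
                  (length-filter-⋃ t-meets-G? (λ S′ → S ∪ S′ ⊆?_) (subsets W 1) (members 𝓕) contains-S∪S′
                                   (All.map degree-S∪S′≤ (subsets-⊆∧size W 1))) ⟩
    s + length (subsets W 1) * bound d
      ≡⟨ cong (λ m → s + m * bound d) (trans (length-subsets W 1) (trans (nC1≡n ∣ W ∣) ∣W∣≡r)) ⟩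
    s + r * bound d ∎
    where
    open ≤-Reasoning
    t-meets-G? = λ A → (S ⊆? A) ×-dec (t ≤? ∣ G ∩ A ∣)
    split : ∀ {A} → S ⊆ A → ∣ G ∩ A ∣ < t ⊎ (S ⊆ A × t ≤ ∣ G ∩ A ∣)
    split {A} S⊆A with ∣ G ∩ A ∣ <? t
    ... | yes ∣G∩A∣<t = inj₁ ∣G∩A∣<t
    ... | no  ∣G∩A∣≮t = inj₂ (S⊆A , ≮⇒≥ ∣G∩A∣≮t)
    contains-S∪S′ : ∀ {A} → S ⊆ A × t ≤ ∣ G ∩ A ∣ → Any (λ S′ → S ∪ S′ ⊆ A) (subsets W 1)
    contains-S∪S′ {A} (S⊆A , t≤∣G∩A∣) = Any.map (∪-⊆ S⊆A)
      (subsets-⊆ W A 1 (t≤∣G∩A∣⇒1≤∣W∩A∣ G∈𝓖 (⊆-trans W⊆G─S (p─q⊆p G S)) ∣W∣≡r t≤∣G∩A∣))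
    degree-S∪S′≤ : ∀ {S′} → S′ ⊆ W × ∣ S′ ∣ ≡ 1 → degree (S ∪ S′) ≤ bound d
    degree-S∪S′≤ {S′} (S′⊆W , ∣S′∣≡1) = degree≤ (S ∪ S′) (begin-equality
      ∣ S ∪ S′ ∣ + d      ≡⟨ cong (_+ d) (∣p∪q∣≡∣p∣+∣q∣ S S′ (⊆-trans S′⊆W (⊆-trans W⊆G─S (p─q⊆∁q G S)))) ⟩
      ∣ S ∣ + ∣ S′ ∣ + d  ≡⟨ cong (λ m → ∣ S ∣ + m + d) ∣S′∣≡1 ⟩
      ∣ S ∣ + 1 + d       ≡⟨ +-assoc ∣ S ∣ 1 d ⟩
      ∣ S ∣ + suc d       ≡⟨ ∣S∣+1+d≡y ⟩
      y                   ∎)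

  <τ⇒∃-t-disjoint : ∀ {S} → ∣ S ∣ < y → ∃ λ G → G ∈ members 𝓖 × ∣ S ∩ G ∣ < t
  <τ⇒∃-t-disjoint {S} ∣S∣<y
    with find (Allₚ.¬All⇒Any¬ (λ B → t ≤? ∣ S ∩ B ∣) (members 𝓖) S-not-cover)
    where
    S-not-cover : ¬ All (λ B → t ≤ ∣ S ∩ B ∣) (members 𝓖)
    S-not-cover S-cover = <⇒≱ ∣S∣<y (proj₂ τ𝓖 S (λ B B∈𝓖 → All.lookup S-cover B∈𝓖))
  ... | G , G∈𝓖 , t≰∣S∩G∣ = G , G∈𝓖 , ≰⇒> t≰∣S∩G∣

  degree≤ : ∀ d S → ∣ S ∣ + d ≡ y → degree S ≤ bound d
  degree≤ zero    S ∣S∣+0≡y = degree-base S (trans (sym (+-identityʳ ∣ S ∣)) ∣S∣+0≡y)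
  degree≤ (suc d) S ∣S∣+1+d≡y
    with G , G∈𝓖 , ∣S∩G∣<t ← <τ⇒∃-t-disjoint {S} (subst (∣ S ∣ <_) ∣S∣+1+d≡y (m<m+n ∣ S ∣ z<s)) =
    degree-step (degree≤ d) ∣S∣+1+d≡y G∈𝓖 ∣S∩G∣<t

  card≤ : ∀ {x} → IsTauT t 𝓕 x → card 𝓕 ≤ (x C t) * bound (y ∸ t)
  card≤ {x} ((T , T-cover , ∣T∣≡x) , _) = begin
    card 𝓕
      ≡⟨ cong length (filter-all t-meets-T? (All.tabulate (λ {A} → T-cover A))) ⟨
    length (filter t-meets-T? (members 𝓕))
      ≤⟨ length-filter-⋃ t-meets-T? (λ S → S ⊆?_) (subsets T t) (members 𝓕) (subsets-⊆ T _ t)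
                         (All.map degree-S≤ (subsets-⊆∧size T t)) ⟩
    length (subsets T t) * bound (y ∸ t)
      ≡⟨ cong (_* bound (y ∸ t)) (trans (length-subsets T t) (cong (_C t) ∣T∣≡x)) ⟩
    (x C t) * bound (y ∸ t) ∎
    where
    open ≤-Reasoning
    t-meets-T? = λ A → t ≤? ∣ T ∩ A ∣
    degree-S≤ : ∀ {S} → S ⊆ T × ∣ S ∣ ≡ t → degree S ≤ bound (y ∸ t)
    degree-S≤ {S} (_ , ∣S∣≡t) =
      degree≤ (y ∸ t) S (trans (cong (_+ (y ∸ t)) ∣S∣≡t) (m+[n∸m]≡n (t≤τ 𝓖 𝓖≢[] τ𝓖)))

lemma2p3 : (n k t s : ℕ) → 0 < n → 0 < k → 0 < t → 0 < s →
    t + 1 ≤ k → (t + 1) * (k ∸ t + 1) ^ 2 ≤ n →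
    (𝓕 𝓖 : Family n) → Uniform k 𝓕 → Uniform k 𝓖 →
    members 𝓕 ≢ [] → members 𝓖 ≢ [] →
    AlmostCrossInt s t 𝓕 𝓖 →
    (x y : ℕ) → IsTauT t 𝓕 x → IsTauT t 𝓖 y → x ≤ k → y ≤ k →
    card 𝓕 * card 𝓖 ≤ f₁ n k t s x * f₁ n k t s y
lemma2p3 n k t s _ _ _ _ t+1≤k _ 𝓕 𝓖 𝓕-uniform 𝓖-uniform 𝓕≢[] 𝓖≢[] (𝓕-almost , 𝓖-almost)
         x y τ𝓕 τ𝓖 x≤k y≤k = begin
  card 𝓕 * card 𝓖
    ≤⟨ *-mono-≤ (Degree.card≤ k t s t≤k 𝓕 𝓖 𝓕-uniform 𝓖-uniform 𝓖≢[] 𝓖-almost τ𝓖 y≤k τ𝓕)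
                (Degree.card≤ k t s t≤k 𝓖 𝓕 𝓖-uniform 𝓕-uniform 𝓕≢[] 𝓕-almost τ𝓕 x≤k τ𝓖) ⟩
  ((x C t) * B y) * ((y C t) * B x)
    ≡⟨ solve 4 (λ a b c d → (a :* b) :* (c :* d) := (a :* d) :* (c :* b)) refl (x C t) (B y) (y C t) (B x) ⟩
  ((x C t) * B x) * ((y C t) * B y)
    ≡⟨ cong₂ _*_ (*-branchingBound (k ∸ t + 1) s (x C t) ((n ∸ x) C (k ∸ x)) (x ∸ t))
                 (*-branchingBound (k ∸ t + 1) s (y C t) ((n ∸ y) C (k ∸ y)) (y ∸ t)) ⟩
  f₁ n k t s x * f₁ n k t s y ∎
  where
  open ≤-Reasoning
  t≤k : t ≤ k
  t≤k = ≤-trans (m≤m+n t 1) t+1≤k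
  B : ℕ → ℕ
  B z = branchingBound (k ∸ t + 1) s ((n ∸ z) C (k ∸ z)) (z ∸ t)
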